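{- Let $\mathcal{A}=\{H_1,\dots,H_n\}$ be a central hyperplane arrangement in $\mathbb{R}^\ell$ and $\mathcal{K}=\bigcap_{i\in W}H_i^+$ a cone, $W\subseteq[n]$. Let $\varphi:\mathbb{Z}[e_1,\dots,e_n]\to VG(\mathcal{K})$ be the ring homomorphism sending $e_i$ to the Heaviside function $x_i$. Then every polynomial in $\mathcal{G}$ lies in $\ker\varphi$.
   Context: $H_i=\{\mathbf{x}: v_i\cdot\mathbf{x}=0\}$ with fixed normal vectors $v_i$, $H_i^+=\{v_i\cdot\mathbf{x}>0\}$. $\mathcal{C}(\mathcal{K})$ is the set of chambers (connected components of $\mathbb{R}^\ell\setminus\bigcup_iH_i$) contained in $\mathcal{K}$; $VG(\mathcal{K})$ is the ring of functions $\mathcal{C}(\mathcal{K})\to\mathbb{Z}$ under pointwise operations, and $x_i(C)=1$ if $C\subseteq H_i^+$, $0$ otherwise. A signed dependency is a pair $(D^+,D^-)$ of disjoint subsets of $[n]$ with $D^+=\{i:\lambda_i>0\}$, $D^-=\{i:\lambda_i<0\}$ for a linear relation $\sum\lambda_iv_i=0$; $\underline{D}=D^+\cup D^-$; a signed circuit is a nonzero signed dependency with $\underline{C}$ inclusion-minimal. $e_S=\prod_{i\in S}e_i$. $\mathcal{G}$ consists of: $e_i^2-e_i$ for $i\in[n]$; $e_i-1$ for $i\in W$; for each signed circuit $C$ with $\emptyset\ne W\cap C^+=W\cap\underline{C}$, $e_{C^+\setminus W}\prod_{j\in C^- }(e_j-1)$, and for each with $\emptyset\ne W\cap C^-=W\cap\underline{C}$,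 $e_{C^-\setminus W}\prod_{j\in C^+}(e_j-1)$; for each signed circuit with $W\cap\underline{C}=\emptyset$, $e_{C^+}\prod_{j\in C^- }(e_j-1)-e_{C^- }\prod_{j\in C^+}(e_j-1)$. -}

module Defs where

open import Level using (Level; _⊔_) renaming (suc to lsuc)
open import Data.Nat using (ℕ)
open import Data.Bool using (Bool; true; false; if_then_else_)
open import Data.Fin using (Fin)
open import Data.Fin.Subset using (Subset; _∈_; _⊆_; _∩_; _∪_; _─_; Nonempty)
open import Data.Integer using (ℤ; +_) renaming (_+_ to _+ℤ_; _*_ to _*ℤ_; -_ to -ℤ_)
open import Data.List using (List; foldr; allFin)
open import Data.Vec using (lookup)
open import Data.Product using (Σ; ∃; _×_)
open import Function.Bundles using (_⇔_)
open import Relation.Nullary using (¬_; does)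
open import Relation.Binary.Core using (Rel)
open import Relation.Binary.Structures using (IsStrictTotalOrder)
open import Relation.Binary.PropositionalEquality using (_≡_)
open import Algebra.Bundles using (CommutativeRing)

-- Ordered fields (stand-in for ℝ, which agda-stdlib lacks)

record OrderedField (c ℓ₁ ℓ₂ : Level) : Set (lsuc (c ⊔ ℓ₁ ⊔ ℓ₂)) where
  field
    commutativeRing : CommutativeRing c ℓ₁
  open CommutativeRing commutativeRing public
  field
    _<_                : Rel Carrier ℓ₂
    isStrictTotalOrder : IsStrictTotalOrder _≈_ _<_
    nontrivial         : ¬ (1# ≈ 0#)
    +-mono-<           : ∀ {x y} z → x < y → (x + z) < (y + z)
    *-pos              : ∀ {x y} → 0# < x → 0# < y → 0# < (x * y)
    inverse            : ∀ x → ¬ (x ≈ 0#) → ∃ λ y → (x * y) ≈ 1#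
  open IsStrictTotalOrder isStrictTotalOrder public using (_<?_)

-- Integer polynomials ℤ[e₁,…,eₙ], as ring expressions

data Poly (n : ℕ) : Set where
  con  : ℤ → Poly n
  e    : Fin n → Poly n
  _⊕_  : Poly n → Poly n → Poly n
  _⊗_  : Poly n → Poly n → Poly n
  ⊝_   : Poly n → Poly n

infixl 6 _⊕_ _⊖_
infixl 7 _⊗_

_⊖_ : ∀ {n} → Poly n → Poly n → Poly n
p ⊖ q = p ⊕ (⊝ q)

eval : ∀ {n} → (Fin n → ℤ) → Poly n → ℤ
eval a (con z) = z
eval a (e i)   = a i
eval a (p ⊕ q) = eval a p +ℤ eval a q
eval a (p ⊗ q) = eval a p *ℤ eval a q
eval a (⊝ p)   = -ℤ eval a p

prodOver : ∀ {n} → Subset n → (Fin n → Poly n) → Poly n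
prodOver {n} S f =
  foldr (λ i acc → if lookup S i then f i ⊗ acc else acc) (con (+ 1)) (allFin n)

eS : ∀ {n} → Subset n → Poly n
eS S = prodOver S e

eMinus1 : ∀ {n} → Subset n → Poly n
eMinus1 S = prodOver S (λ j → e j ⊖ con (+ 1))

module Arrangement {c ℓ₁ ℓ₂} (F : OrderedField c ℓ₁ ℓ₂)
                   {ℓ n : ℕ} (v : Fin n → Fin ℓ → OrderedField.Carrier F)
                   (W : Subset n) where
  open OrderedField F

  sumF : ∀ {k} → (Fin k → Carrier) → Carrier
  sumF {k} f = foldr (λ i acc → f i + acc) 0# (allFin k)

  dot : Fin n → (Fin ℓ → Carrier) → Carrier
  dot i x = sumF (λ j → v i j * x j)

  SignedDependency : Subset n → Subset n → Set (c ⊔ ℓ₁ ⊔ ℓ₂)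
  SignedDependency D⁺ D⁻ =
    Σ (Fin n → Carrier) λ lam →
      (∀ j → sumF (λ i → lam i * v i j) ≈ 0#) ×
      (∀ i → (i ∈ D⁺ ⇔ (0# < lam i)) × (i ∈ D⁻ ⇔ (lam i < 0#)))

  SignedCircuit : Subset n → Subset n → Set (c ⊔ ℓ₁ ⊔ ℓ₂)
  SignedCircuit C⁺ C⁻ =
    SignedDependency C⁺ C⁻ × Nonempty (C⁺ ∪ C⁻) ×
    (∀ E⁺ E⁻ → SignedDependency E⁺ E⁻ → Nonempty (E⁺ ∪ E⁻) →
       (E⁺ ∪ E⁻) ⊆ (C⁺ ∪ C⁻) → (C⁺ ∪ C⁻) ⊆ (E⁺ ∪ E⁻))

  data InG : Poly n → Set (c ⊔ ℓ₁ ⊔ ℓ₂) where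
    idem   : ∀ i → InG (e i ⊗ e i ⊖ e i)
    inW    : ∀ i → i ∈ W → InG (e i ⊖ con (+ 1))
    circ⁺  : ∀ C⁺ C⁻ → SignedCircuit C⁺ C⁻ →
             Nonempty (W ∩ C⁺) → W ∩ C⁺ ≡ W ∩ (C⁺ ∪ C⁻) →
             InG (eS (C⁺ ─ W) ⊗ eMinus1 C⁻)
    circ⁻  : ∀ C⁺ C⁻ → SignedCircuit C⁺ C⁻ →
             Nonempty (W ∩ C⁻) → W ∩ C⁻ ≡ W ∩ (C⁺ ∪ C⁻) →
             InG (eS (C⁻ ─ W) ⊗ eMinus1 C⁺)
    circ₀  : ∀ C⁺ C⁻ → SignedCircuit C⁺ C⁻ →
             W ∩ (C⁺ ∪ C⁻) ≡ Data.Fin.Subset.⊥ →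
             InG (eS C⁺ ⊗ eMinus1 C⁻ ⊖ eS C⁻ ⊗ eMinus1 C⁺)

  InChamberOfK : (Fin ℓ → Carrier) → Set (ℓ₁ ⊔ ℓ₂)
  InChamberOfK x = (∀ i → ¬ (dot i x ≈ 0#)) × (∀ i → i ∈ W → 0# < dot i x)

  heaviside : (Fin ℓ → Carrier) → Fin n → ℤ
  heaviside x i = if does (0# <? dot i x) then + 1 else + 0

  -- φ(p) evaluated on the chamber containing x
  φ : Poly n → (Fin ℓ → Carrier) → ℤ
  φ p x = eval (heaviside x) p

  InKer : Poly n → Set (c ⊔ ℓ₁ ⊔ ℓ₂)
  InKer p = ∀ x → InChamberOfK x → φ p x ≡ + 0

{-# OPTIONS --safe #-}
module Submission where

open import Defs
open import Data.Nat using (ℕ)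
import Data.Nat as ℕ
open import Data.Fin using (Fin; zero; suc)
open import Data.Fin.Subset using (Subset; _∈_; _⊆_; _∪_; _─_; Nonempty)
open import Data.Fin.Subset.Properties
  using (_∈?_; x∈p∪q⁻; x∈p∧x∉q⇒x∈p─q; p─q⊆p; ∪-comm)
open import Data.Bool using (true; false; if_then_else_)
open import Data.Integer using (ℤ; +_; _≟_) renaming (_+_ to _+ℤ_; _*_ to _*ℤ_; -_ to -ℤ_)
import Data.Integer.Properties as ℤ
open import Data.List using (_∷_; foldr; tabulate; allFin)
open import Data.List.Membership.Propositional using () renaming (_∈_ to _∈ₗ_)
open import Data.List.Membership.Propositional.Properties using (∈-allFin)
open import Data.List.Relation.Unary.Any using (here; there)
open import Data.Vec using (lookup)
open import Data.Vec.Properties using ([]=⇒lookup)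
open import Data.Empty using (⊥)
open import Data.Product using (_×_; _,_; proj₁; proj₂)
open import Data.Sum using (_⊎_; inj₁; inj₂; [_,_]′)
open import Function using (_∘_; id)
open import Function.Bundles using (_⇔_; mk⇔; Equivalence)
open import Function.Construct.Composition using (_⇔-∘_)
open import Relation.Nullary using (¬_; yes; no; contradiction)
open import Relation.Nullary.Decidable using (dec-true; dec-false; decidable-stable)
open import Relation.Binary.Definitions using (tri<; tri≈; tri>)
open import Relation.Binary.Structures using (IsStrictTotalOrder)
import Relation.Binary.PropositionalEquality as ≡
open ≡ using (_≡_; _≢_)
import Algebra.Properties.Ring as RingProperties
import Algebra.Properties.Semiring.Sum as SemiringSum
import Relation.Binary.Construct.StrictToNonStrict as StrictToNonStrict

-- Fix a point x in a chamber of 𝒦. Its Heaviside values are 0 or 1, so e_i² − e_i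
-- vanishes at x, and so does e_i − 1 for i ∈ W because 𝒦 ⊆ H_i⁺. For a signed
-- dependency (D⁺, D⁻) with nonempty support, a monomial e_S ∏_{j∈D⁻} (e_j − 1) with
-- D⁺ ∖ W ⊆ S can only be nonzero at x if v_i·x > 0 on D⁺ (on D⁺ ∩ W by the cone
-- condition) and v_j·x < 0 on D⁻ (x lies on no hyperplane). But then
-- Σ λ_i (v_i·x) = (Σ λ_i v_i)·x = 0 is a sum of nonnegative terms which is positive
-- on the support, a contradiction. Negating λ swaps D⁺ and D⁻ and handles the
-- monomials with the roles reversed.

module _ {n : ℕ} (a : Fin n → ℤ) where

  eval-prodOver-≡0 : ∀ {S} (f : Fin n → Poly n) {i} → i ∈ S → eval a (f i) ≡ + 0 →
                     eval a (prodOver S f) ≡ + 0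
  eval-prodOver-≡0 {S} f {i} i∈S fi≡0 = go (allFin n) (∈-allFin i)
    where
    go : ∀ L → i ∈ₗ L →
         eval a (foldr (λ k acc → if lookup S k then f k ⊗ acc else acc) (con (+ 1)) L) ≡ + 0
    go (_ ∷ L) (here ≡.refl) rewrite []=⇒lookup i∈S | fi≡0 = ≡.refl
    go (k ∷ L) (there i∈L) with lookup S k
    ... | true  rewrite go L i∈L = ℤ.*-zeroʳ (eval a (f k))
    ... | false = go L i∈L

  eval-eS⊗-≡0 : ∀ {S} (q : Poly n) {i} → i ∈ S → a i ≡ + 0 → eval a (eS S ⊗ q) ≡ + 0
  eval-eS⊗-≡0 q i∈S ai≡0 =
    ≡.trans (≡.cong (_*ℤ eval a q) (eval-prodOver-≡0 e i∈S ai≡0)) (ℤ.*-zeroˡ (eval a q))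

  eval-⊗eMinus1-≡0 : ∀ {T} (p : Poly n) {j} → j ∈ T → a j ≡ + 1 →
                     eval a (p ⊗ eMinus1 T) ≡ + 0
  eval-⊗eMinus1-≡0 p j∈T aj≡1 =
    ≡.trans (≡.cong (eval a p *ℤ_) (eval-prodOver-≡0 _ j∈T (≡.cong (_+ℤ -ℤ + 1) aj≡1)))
            (ℤ.*-zeroʳ (eval a p))

module OrderedFieldProperties {c ℓ₁ ℓ₂} (F : OrderedField c ℓ₁ ℓ₂) where

  open OrderedField F hiding (zero)
  open IsStrictTotalOrder isStrictTotalOrder using (compare; <-respˡ-≈; <-respʳ-≈)
    renaming (trans to <-trans)
  open RingProperties ring using (-‿involutive; -‿distribˡ-*; -‿distribʳ-*)
  open StrictToNonStrict _≈_ _<_ public using (_≤_; <⇒≤)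
  open SemiringSum semiring using (sum)

  <-resp₂-≈ : ∀ {x x′ y y′} → x ≈ x′ → y ≈ y′ → x < y → x′ < y′
  <-resp₂-≈ x≈x′ y≈y′ = <-respˡ-≈ x≈x′ ∘ <-respʳ-≈ y≈y′

  neg⇔-pos : ∀ {x} → x < 0# ⇔ 0# < (- x)
  neg⇔-pos {x} = mk⇔
    (<-resp₂-≈ (-‿inverseʳ x) (+-identityˡ (- x)) ∘ +-mono-< (- x))
    (<-resp₂-≈ (+-identityˡ x) (-‿inverseˡ x) ∘ +-mono-< x)

  pos⇔-neg : ∀ {x} → 0# < x ⇔ (- x) < 0#
  pos⇔-neg {x} = mk⇔
    (<-resp₂-≈ (+-identityˡ (- x)) (-‿inverseʳ x) ∘ +-mono-< (- x))
    (<-resp₂-≈ (-‿inverseˡ x) (+-identityˡ x) ∘ +-mono-< x)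

  neg*neg-pos : ∀ {x y} → x < 0# → y < 0# → 0# < (x * y)
  neg*neg-pos {x} {y} x<0 y<0 =
    <-respʳ-≈ -x*-y≈x*y (*-pos (Equivalence.to neg⇔-pos x<0) (Equivalence.to neg⇔-pos y<0))
    where
    -x*-y≈x*y : - x * - y ≈ x * y
    -x*-y≈x*y = trans (sym (-‿distribˡ-* x (- y)))
                      (trans (-‿cong (sym (-‿distribʳ-* x y))) (-‿involutive (x * y)))

  nonpos-nonzero⇒neg : ∀ {x} → ¬ (0# < x) → ¬ (x ≈ 0#) → x < 0#
  nonpos-nonzero⇒neg {x} x≯0 x≉0 with compare x 0#
  ... | tri< x<0 _ _ = x<0
  ... | tri≈ _ x≈0 _ = contradiction x≈0 x≉0
  ... | tri> _ _ x>0 = contradiction x>0 x≯0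

  pos+nonneg-pos : ∀ {x y} → 0# < x → 0# ≤ y → 0# < (x + y)
  pos+nonneg-pos {x} {y} 0<x =
    [ (λ 0<y → <-trans 0<y y<x+y) , (λ 0≈y → <-respˡ-≈ (sym 0≈y) y<x+y) ]′
    where
    y<x+y : y < (x + y)
    y<x+y = <-respˡ-≈ (+-identityˡ y) (+-mono-< y 0<x)

  nonneg+nonneg-nonneg : ∀ {x y} → 0# ≤ x → 0# ≤ y → 0# ≤ (x + y)
  nonneg+nonneg-nonneg (inj₁ 0<x) 0≤y = <⇒≤ (pos+nonneg-pos 0<x 0≤y)
  nonneg+nonneg-nonneg {x} {y} (inj₂ 0≈x) (inj₁ 0<y) =
    <⇒≤ (<-respʳ-≈ (+-comm y x) (pos+nonneg-pos 0<y (inj₂ 0≈x)))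
  nonneg+nonneg-nonneg (inj₂ 0≈x) (inj₂ 0≈y) =
    inj₂ (trans (sym (+-identityˡ 0#)) (+-cong 0≈x 0≈y))

  sum-nonneg : ∀ {k} (t : Fin k → Carrier) → (∀ i → 0# ≤ t i) → 0# ≤ sum t
  sum-nonneg {ℕ.zero}  t t≥0 = inj₂ refl
  sum-nonneg {ℕ.suc k} t t≥0 =
    nonneg+nonneg-nonneg (t≥0 zero) (sum-nonneg (t ∘ suc) (t≥0 ∘ suc))

  sum-pos : ∀ {k} (t : Fin k → Carrier) → (∀ i → 0# ≤ t i) → ∀ i → 0# < t i → 0# < sum t
  sum-pos t t≥0 zero 0<t₀ = pos+nonneg-pos 0<t₀ (sum-nonneg (t ∘ suc) (t≥0 ∘ suc))
  sum-pos {ℕ.suc k} t t≥0 (suc i) 0<tᵢ =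
    <-respʳ-≈ (+-comm _ (t zero))
              (pos+nonneg-pos (sum-pos (t ∘ suc) (t≥0 ∘ suc) i 0<tᵢ) (t≥0 zero))

module ArrangementProperties {c ℓ₁ ℓ₂} (F : OrderedField c ℓ₁ ℓ₂) {ℓ n : ℕ}
                             (v : Fin n → Fin ℓ → OrderedField.Carrier F) (W : Subset n) where

  open OrderedField F hiding (zero)
  open IsStrictTotalOrder isStrictTotalOrder using (compare; irrefl)
  open RingProperties ring using (-‿distribˡ-*; -1*x≈-x)
  open SemiringSum semiring using (sum; sum-syntax; sum-cong-≋; ∑-comm;
                                   *-distribˡ-sum; *-distribʳ-sum; sum-replicate-zero)
  open OrderedFieldProperties F
  open Arrangement F v W
  open import Relation.Binary.Reasoning.Setoid setoid

  foldr-tabulate : ∀ {k} {A : Set} (f : A → Carrier) (g : Fin k → A) →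
                   foldr (λ a acc → f a + acc) 0# (tabulate g) ≡ sum (f ∘ g)
  foldr-tabulate {ℕ.zero}  f g = ≡.refl
  foldr-tabulate {ℕ.suc k} f g = ≡.cong (_+_ (f (g zero))) (foldr-tabulate f (g ∘ suc))

  sumF≡sum : ∀ {k} (f : Fin k → Carrier) → sumF f ≡ sum f
  sumF≡sum f = foldr-tabulate f id

  linear-relation-annihilates : (lam : Fin n → Carrier) →
                                (∀ j → sumF (λ i → lam i * v i j) ≈ 0#) →
                                ∀ x → sumF (λ i → lam i * dot i x) ≈ 0#
  linear-relation-annihilates lam relation x = begin
    sumF (λ i → lam i * dot i x)
      ≡⟨ sumF≡sum (λ i → lam i * dot i x) ⟩
    ∑[ i < n ] (lam i * dot i x)
      ≈⟨ sum-cong-≋ {n} (λ i → *-congˡ (reflexive (sumF≡sum (λ j → v i j * x j)))) ⟩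
    ∑[ i < n ] (lam i * ∑[ j < ℓ ] (v i j * x j))
      ≈⟨ sum-cong-≋ {n} (λ i → *-distribˡ-sum (lam i) (λ j → v i j * x j)) ⟩
    ∑[ i < n ] ∑[ j < ℓ ] (lam i * (v i j * x j))
      ≈⟨ ∑-comm (λ i j → lam i * (v i j * x j)) ⟩
    ∑[ j < ℓ ] ∑[ i < n ] (lam i * (v i j * x j))
      ≈⟨ sum-cong-≋ {ℓ} (λ j → trans
           (sum-cong-≋ {n} (λ i → sym (*-assoc (lam i) (v i j) (x j))))
           (sym (*-distribʳ-sum (x j) (λ i → lam i * v i j)))) ⟩
    ∑[ j < ℓ ] (∑[ i < n ] (lam i * v i j) * x j)
      ≈⟨ sum-cong-≋ {ℓ} (λ j → trans (*-congʳ (relation′ j)) (zeroˡ (x j))) ⟩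
    ∑[ j < ℓ ] 0#
      ≈⟨ sum-replicate-zero ℓ ⟩
    0# ∎
    where
    relation′ : ∀ j → ∑[ i < n ] (lam i * v i j) ≈ 0#
    relation′ j = trans (reflexive (≡.sym (sumF≡sum (λ i → lam i * v i j)))) (relation j)

  SignedDependency-swap : ∀ {D⁺ D⁻} → SignedDependency D⁺ D⁻ → SignedDependency D⁻ D⁺
  SignedDependency-swap (lam , relation , signs) = (λ i → - lam i) , relation⁻ , signs⁻
    where
    relation⁻ : ∀ j → sumF (λ i → - lam i * v i j) ≈ 0#
    relation⁻ j = begin
      sumF (λ i → - lam i * v i j)
        ≡⟨ sumF≡sum (λ i → - lam i * v i j) ⟩
      ∑[ i < n ] (- lam i * v i j)
        ≈⟨ sum-cong-≋ {n} (λ i →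
             sym (trans (-1*x≈-x (lam i * v i j)) (-‿distribˡ-* (lam i) (v i j)))) ⟩
      ∑[ i < n ] (- 1# * (lam i * v i j))
        ≈⟨ *-distribˡ-sum (- 1#) (λ i → lam i * v i j) ⟨
      - 1# * ∑[ i < n ] (lam i * v i j)
        ≈⟨ *-congˡ (trans (reflexive (≡.sym (sumF≡sum (λ i → lam i * v i j)))) (relation j)) ⟩
      - 1# * 0#
        ≈⟨ zeroʳ (- 1#) ⟩
      0# ∎
    signs⁻ : ∀ i → (i ∈ _ ⇔ 0# < (- lam i)) × (i ∈ _ ⇔ (- lam i) < 0#)
    signs⁻ i = neg⇔-pos ⇔-∘ proj₂ (signs i) , pos⇔-neg ⇔-∘ proj₁ (signs i)

  SignedDependency-unrealisable : ∀ {D⁺ D⁻} x → SignedDependency D⁺ D⁻ → Nonempty (D⁺ ∪ D⁻) →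
                                  (∀ {i} → i ∈ D⁺ → 0# < dot i x) →
                                  (∀ {i} → i ∈ D⁻ → dot i x < 0#) → ⊥
  SignedDependency-unrealisable {D⁺} {D⁻} x (lam , relation , signs) (i₀ , i₀∈D) pos neg =
    irrefl (sym (linear-relation-annihilates lam relation x))
      (≡.subst (0# <_) (≡.sym (sumF≡sum term))
        (sum-pos term term-nonneg i₀ (term-pos (x∈p∪q⁻ D⁺ D⁻ i₀∈D))))
    where
    term : Fin n → Carrier
    term i = lam i * dot i x
    term-pos : ∀ {i} → i ∈ D⁺ ⊎ i ∈ D⁻ → 0# < term i
    term-pos {i} (inj₁ i∈D⁺) = *-pos (Equivalence.to (proj₁ (signs i)) i∈D⁺) (pos i∈D⁺)
    term-pos {i} (inj₂ i∈D⁻) = neg*neg-pos (Equivalence.to (proj₂ (signs i)) i∈D⁻) (neg i∈D⁻)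
    term-nonneg : ∀ i → 0# ≤ term i
    term-nonneg i with compare (lam i) 0#
    ... | tri< λ<0 _ _ = <⇒≤ (term-pos (inj₂ (Equivalence.from (proj₂ (signs i)) λ<0)))
    ... | tri≈ _ λ≈0 _ = inj₂ (sym (trans (*-congʳ λ≈0) (zeroˡ (dot i x))))
    ... | tri> _ _ λ>0 = <⇒≤ (term-pos (inj₁ (Equivalence.from (proj₁ (signs i)) λ>0)))

  module _ {x : Fin ℓ → Carrier} where

    heaviside-pos : ∀ {i} → 0# < dot i x → heaviside x i ≡ + 1
    heaviside-pos {i} 0<vᵢx =
      ≡.cong (λ b → if b then + 1 else + 0) (dec-true (0# <? dot i x) 0<vᵢx)

    heaviside-nonpos : ∀ {i} → ¬ (0# < dot i x) → heaviside x i ≡ + 0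
    heaviside-nonpos {i} vᵢx≯0 =
      ≡.cong (λ b → if b then + 1 else + 0) (dec-false (0# <? dot i x) vᵢx≯0)

    heaviside-idempotent : ∀ i → heaviside x i *ℤ heaviside x i ≡ heaviside x i
    heaviside-idempotent i with 0# <? dot i x
    ... | yes _ = ≡.refl
    ... | no _  = ≡.refl

    φ-idempotent-≡0 : ∀ i → φ (e i ⊗ e i ⊖ e i) x ≡ + 0
    φ-idempotent-≡0 i =
      ≡.trans (≡.cong (_+ℤ -ℤ heaviside x i) (heaviside-idempotent i))
              (ℤ.+-inverseʳ (heaviside x i))

  dependency-monomial-vanishes : ∀ {x} → InChamberOfK x →
                                 ∀ {D⁺ D⁻ S} → SignedDependency D⁺ D⁻ → Nonempty (D⁺ ∪ D⁻) →
                                 D⁺ ─ W ⊆ S → φ (eS S ⊗ eMinus1 D⁻) x ≡ + 0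
  dependency-monomial-vanishes {x} (off-hyperplanes , in-cone) {D⁺} {D⁻} {S}
                               dep nonempty D⁺─W⊆S =
    decidable-stable (φ (eS S ⊗ eMinus1 D⁻) x ≟ + 0) λ φ≢0 →
      SignedDependency-unrealisable x dep nonempty (positive φ≢0) (negative φ≢0)
    where
    positive : φ (eS S ⊗ eMinus1 D⁻) x ≢ + 0 → ∀ {i} → i ∈ D⁺ → 0# < dot i x
    positive φ≢0 {i} i∈D⁺ with i ∈? W
    ... | yes i∈W = in-cone i i∈W
    ... | no i∉W = decidable-stable (0# <? dot i x) λ vᵢx≯0 →
      φ≢0 (eval-eS⊗-≡0 (heaviside x) (eMinus1 D⁻) (D⁺─W⊆S (x∈p∧x∉q⇒x∈p─q i∈D⁺ i∉W))
                       (heaviside-nonpos vᵢx≯0))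
    negative : φ (eS S ⊗ eMinus1 D⁻) x ≢ + 0 → ∀ {i} → i ∈ D⁻ → dot i x < 0#
    negative φ≢0 {i} i∈D⁻ = nonpos-nonzero⇒neg
      (λ 0<vᵢx → φ≢0 (eval-⊗eMinus1-≡0 (heaviside x) (eS S) i∈D⁻ (heaviside-pos 0<vᵢx)))
      (off-hyperplanes i)

  circuit-monomial-vanishes : ∀ {x} → InChamberOfK x → ∀ {C⁺ C⁻ S} → SignedCircuit C⁺ C⁻ →
                              C⁺ ─ W ⊆ S → φ (eS S ⊗ eMinus1 C⁻) x ≡ + 0
  circuit-monomial-vanishes x∈K (dep , nonempty , _) =
    dependency-monomial-vanishes x∈K dep nonempty

  circuit-monomial-vanishes⁻ : ∀ {x} → InChamberOfK x → ∀ {C⁺ C⁻ S} → SignedCircuit C⁺ C⁻ →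
                               C⁻ ─ W ⊆ S → φ (eS S ⊗ eMinus1 C⁺) x ≡ + 0
  circuit-monomial-vanishes⁻ x∈K {C⁺} {C⁻} (dep , nonempty , _) =
    dependency-monomial-vanishes x∈K (SignedDependency-swap dep)
      (≡.subst Nonempty (∪-comm C⁺ C⁻) nonempty)

proposition3p1 : ∀ {c a b} (F : OrderedField c a b) (ℓ n : ℕ)
                   (v : Fin n → Fin ℓ → OrderedField.Carrier F) (W : Subset n)
                   (p : Poly n) →
                   Arrangement.InG F v W p → Arrangement.InKer F v W p
proposition3p1 F ℓ n v W p p∈𝒢 x x∈K = vanishes p∈𝒢
  where
  open Arrangement F v W
  open ArrangementProperties F v W
  vanishes : ∀ {q} → InG q → φ q x ≡ + 0
  vanishes (idem i)          = φ-idempotent-≡0 i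
  vanishes (inW i i∈W)       = ≡.cong (_+ℤ -ℤ + 1) (heaviside-pos (proj₂ x∈K i i∈W))
  vanishes (circ⁺ _ _ C _ _) = circuit-monomial-vanishes x∈K C id
  vanishes (circ⁻ _ _ C _ _) = circuit-monomial-vanishes⁻ x∈K C id
  vanishes (circ₀ C⁺ C⁻ C _) = ≡.cong₂ (λ s t → s +ℤ -ℤ t)
    (circuit-monomial-vanishes x∈K C (p─q⊆p C⁺ W))
    (circuit-monomial-vanishes⁻ x∈K C (p─q⊆p C⁻ W))
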